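{- Let $f:\{0,1\}^n\to\{0,1\}$ be a monotone boolean function with expectation $\mu$ (uniform measure), let $0\le r\le n$, let $g=\mathbb{E}(f\mid\mathcal{F}_r)$ and $h=f-g$. If $\|h\|_2^2\le\mu-2\mu^2$, then $$\Pr\{f(x)=1\mid x_1=\dots=x_r=1\}\ \ge\ 2\mu.$$
   Context: $\{0,1\}^n$ carries the uniform probability measure, $\|h\|_2^2=\mathbb{E}h^2$. $\mathcal{F}_r$ is the algebra of subsets of $\{0,1\}^n$ generated by the first $r$ coordinates, so $g(x)$ is the average of $f$ over all points agreeing with $x$ in the first $r$ coordinates. Monotone means $x\le y$ coordinatewise implies $f(x)\le f(y)$. -}

module Defs where

open import Data.Bool using (Bool; true; false; _∧_; if_then_else_)
open import Data.Bool.Properties using (_≟_)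
open import Data.Nat using (ℕ; zero; suc)
open import Data.Integer using (+_)
open import Data.List using (List; []; _∷_; [_]; map; _++_; length; foldr; filter)
open import Data.Vec using (Vec; []; _∷_)
open import Data.Rational using (ℚ; 0ℚ; 1ℚ; _+_; _*_; _-_; _/_)
open import Relation.Nullary.Decidable using (⌊_⌋)
open import Relation.Unary using (Pred)
open import Level using (0ℓ)

cube : (n : ℕ) → List (Vec Bool n)
cube zero = [ [] ]
cube (suc n) = map (false ∷_) (cube n) ++ map (true ∷_) (cube n)

sumℚ : List ℚ → ℚ
sumℚ = foldr _+_ 0ℚ

avg : List ℚ → ℚ
avg [] = 0ℚ
avg (q ∷ qs) = sumℚ (q ∷ qs) * (+ 1 / suc (length qs))

ind : Bool → ℚ
ind b = if b then 1ℚ else 0ℚ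

E : {n : ℕ} → (Vec Bool n → ℚ) → ℚ
E {n} h = avg (map h (cube n))

data _≤ᵇ_ : Bool → Bool → Set where
  b≤b : ∀ {b} → b ≤ᵇ b
  f≤t : false ≤ᵇ true

data _≤ᵛ_ : {n : ℕ} → Vec Bool n → Vec Bool n → Set where
  []≤[] : [] ≤ᵛ []
  ∷≤∷ : ∀ {n a b} {x y : Vec Bool n} → a ≤ᵇ b → x ≤ᵛ y → (a ∷ x) ≤ᵛ (b ∷ y)

Monotone : {n : ℕ} → (Vec Bool n → Bool) → Set
Monotone {n} f = ∀ (x y : Vec Bool n) → x ≤ᵛ y → f x ≤ᵇ f y

agree : {n : ℕ} → ℕ → Vec Bool n → Vec Bool n → Bool
agree zero _ _ = true
agree (suc r) [] [] = true
agree (suc r) (a ∷ x) (b ∷ y) = ⌊ a ≟ b ⌋ ∧ agree r x y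

firstOnes : {n : ℕ} → ℕ → Vec Bool n → Bool
firstOnes zero _ = true
firstOnes (suc r) [] = true
firstOnes (suc r) (a ∷ x) = a ∧ firstOnes r x

avgOn : {n : ℕ} → (Vec Bool n → Bool) → (Vec Bool n → ℚ) → ℚ
avgOn {n} P h = avg (map h (filter (λ y → P y Data.Bool.≟ true) (cube n)))

-- conditional expectation E(f | F_r): average over points agreeing with x in the first r coordinates
condExp : {n : ℕ} → ℕ → (Vec Bool n → ℚ) → Vec Bool n → ℚ
condExp r h x = avgOn (agree r x) h

condProbOnes : {n : ℕ} → ℕ → (Vec Bool n → Bool) → ℚ
condProbOnes r f = avgOn (firstOnes r) (λ x → ind (f x))

{-# OPTIONS --safe #-}
module Submission where

-- Write p(f) for Pr{f = 1 | x₁ = … = x_r = 1} and h = f − E(f | F_r). The heart of the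
-- proof is the inequality μ − p·μ ≤ ‖h‖², by induction on r. For r = 0, both sides equal
-- μ − μ² because f is 0/1-valued. For r + 1, split the cube along x₁: μ and ‖h‖² are the
-- averages of the corresponding quantities on the faces x₁ = 0 and x₁ = 1 (with r in
-- place of r + 1), p(f) is p on the upper face alone, and by monotonicity p on the lower
-- face is at most p on the upper face. The hypothesis ‖h‖² ≤ μ − 2μ² then gives
-- 2μ·μ ≤ p·μ, hence 2μ ≤ p (trivially so when μ = 0).

open import Defs
open import Data.Bool using (Bool; true; false)
open import Data.Nat using (ℕ) renaming (_≤_ to _≤ℕ_)
open import Data.Vec using (Vec)
open import Data.Rational using (ℚ; _≤_; _*_; _-_; _+_)

open import Data.Bool using (not)
import Data.Bool as Bool
open import Data.Nat using (zero; suc; s≤s)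
import Data.Nat as ℕ
import Data.Nat.Properties as ℕ
open import Data.Integer using (+_)
open import Data.Vec using ([]; _∷_)
open import Data.List using (List; []; _∷_; map; _++_; length; filter)
open import Data.List.Properties
  using (++-identityʳ; map-++; map-∘; map-cong; length-map; length-++; filter-++; filter-all; filter-none)
open import Data.List.Relation.Unary.All using (universal)
open import Data.Rational using (0ℚ; 1ℚ; _/_; ½; toℚᵘ; nonNegative; ≢-nonZero)
open import Data.Rational.Properties
import Data.Rational.Unnormalised as ℚᵘ
import Data.Rational.Unnormalised.Properties as ℚᵘ
open import Data.Rational.Solver using (module +-*-Solver)
open +-*-Solver using (solve; con; _:+_; _:*_; _:-_; _:=_)
open import Function using (_∘_; _$_)
open import Relation.Binary.PropositionalEquality
open import Relation.Nullary using (does; yes; no)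
open import Relation.Unary using (Pred; Decidable)
open import Level using (Level)

private
  variable
    a ℓ : Level
    A B : Set a

sumℚ-++ : ∀ xs ys → sumℚ (xs ++ ys) ≡ sumℚ xs + sumℚ ys
sumℚ-++ []       ys = sym (+-identityˡ (sumℚ ys))
sumℚ-++ (x ∷ xs) ys = trans (cong (_+_ x) (sumℚ-++ xs ys)) (sym (+-assoc x (sumℚ xs) (sumℚ ys)))

1/[k+k]≡½*1/k : ∀ m → + 1 / (suc m ℕ.+ suc m) ≡ ½ * (+ 1 / suc m)
1/[k+k]≡½*1/k m = toℚᵘ-injective $ begin
  toℚᵘ (+ 1 / (suc m ℕ.+ suc m))         ≈⟨ toℚᵘ-fromℚᵘ (ℚᵘ.mkℚᵘ (+ 1) (m ℕ.+ suc m)) ⟩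
  ℚᵘ.mkℚᵘ (+ 1) (m ℕ.+ suc m)             ≈⟨ ℚᵘ.*≡* (cong (λ k → + suc (m ℕ.+ k ℕ.+ 0 ℕ.* suc (m ℕ.+ k))) 1*k≡k) ⟩
  ℚᵘ.mkℚᵘ (+ 1) 1 ℚᵘ.* ℚᵘ.mkℚᵘ (+ 1) m    ≈⟨ ℚᵘ.*-cong (toℚᵘ-fromℚᵘ (ℚᵘ.mkℚᵘ (+ 1) 1)) (toℚᵘ-fromℚᵘ (ℚᵘ.mkℚᵘ (+ 1) m)) ⟨
  toℚᵘ ½ ℚᵘ.* toℚᵘ (+ 1 / suc m)          ≈⟨ toℚᵘ-homo-* ½ (+ 1 / suc m) ⟨
  toℚᵘ (½ * (+ 1 / suc m))                ∎
  where
  open ℚᵘ.≃-Reasoning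
  -- the denominator 2 * suc m of the product unfolds to suc (m + 1 * suc m)
  1*k≡k : 1 ℕ.* suc m ≡ suc m
  1*k≡k = ℕ.*-identityˡ (suc m)

m-p≤m-q⇒q≤p : ∀ {m p q} → m - p ≤ m - q → q ≤ p
m-p≤m-q⇒q≤p {m} {p} {q} m-p≤m-q = begin
  q               ≡⟨ solve 2 (λ m q → q := m :- (m :- q)) refl m q ⟩
  m - (m - q)     ≤⟨ +-monoʳ-≤ m (neg-antimono-≤ m-p≤m-q) ⟩
  m - (m - p)     ≡⟨ solve 2 (λ m p → m :- (m :- p) := p) refl m p ⟩
  p               ∎
  where open ≤-Reasoning

[m+m]*m≤p*m⇒m+m≤p : ∀ {m p} → 0ℚ ≤ m → 0ℚ ≤ p → (m + m) * m ≤ p * m → m + m ≤ p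
[m+m]*m≤p*m⇒m+m≤p {m} 0≤m 0≤p [m+m]m≤pm with m ≟ 0ℚ
... | yes refl = 0≤p
... | no  m≢0  = *-cancelʳ-≤-pos m {{0<m}} [m+m]m≤pm
  where 0<m = nonNeg∧nonZero⇒pos m {{nonNegative 0≤m}} {{≢-nonZero m≢0}}

avg-++ : ∀ (xs ys : List ℚ) → length xs ≡ length ys → avg (xs ++ ys) ≡ ½ * (avg xs + avg ys)
avg-++ []       []       _  = refl
avg-++ (x ∷ xs) (y ∷ ys) eq = begin
  avg ((x ∷ xs) ++ (y ∷ ys))                     ≡⟨ cong (_* (+ 1 / suc ∣xs++y∷ys∣)) (sumℚ-++ (x ∷ xs) (y ∷ ys)) ⟩
  (S + T) * (+ 1 / suc ∣xs++y∷ys∣)               ≡⟨ cong (λ k → (S + T) * (+ 1 / suc k)) ∣xs++y∷ys∣≡m+1+m ⟩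
  (S + T) * (+ 1 / (suc m ℕ.+ suc m))            ≡⟨ cong (_*_ (S + T)) (1/[k+k]≡½*1/k m) ⟩
  (S + T) * (½ * u)                              ≡⟨ solve 3 (λ S T u → (S :+ T) :* (con ½ :* u)
                                                                    := con ½ :* (S :* u :+ T :* u)) refl S T u ⟩
  ½ * (S * u + T * u)                            ≡⟨ cong (λ k → ½ * (S * u + T * (+ 1 / suc k))) ∣xs∣≡∣ys∣ ⟩
  ½ * (avg (x ∷ xs) + avg (y ∷ ys))              ∎
  where
  open ≡-Reasoning
  m = length xs
  S = sumℚ (x ∷ xs)
  T = sumℚ (y ∷ ys)
  u = + 1 / suc m
  ∣xs++y∷ys∣ = length (xs ++ y ∷ ys)
  ∣xs∣≡∣ys∣ = ℕ.suc-injective eq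
  ∣xs++y∷ys∣≡m+1+m : ∣xs++y∷ys∣ ≡ m ℕ.+ suc m
  ∣xs++y∷ys∣≡m+1+m = trans (length-++ xs) (cong (λ k → m ℕ.+ suc k) (sym ∣xs∣≡∣ys∣))

sumℚ-mono : ∀ {F G : A → ℚ} (xs : List A) → (∀ x → F x ≤ G x) → sumℚ (map F xs) ≤ sumℚ (map G xs)
sumℚ-mono []       _   = ≤-refl
sumℚ-mono (x ∷ xs) F≤G = +-mono-≤ (F≤G x) (sumℚ-mono xs F≤G)

sumℚ-nonNeg : ∀ {F : A → ℚ} (xs : List A) → (∀ x → 0ℚ ≤ F x) → 0ℚ ≤ sumℚ (map F xs)
sumℚ-nonNeg []       _   = ≤-refl
sumℚ-nonNeg (x ∷ xs) 0≤F = +-mono-≤ (0≤F x) (sumℚ-nonNeg xs 0≤F)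

avg-map-∷ : ∀ (F : A → ℚ) x xs → avg (map F (x ∷ xs)) ≡ sumℚ (map F (x ∷ xs)) * (+ 1 / suc (length xs))
avg-map-∷ F x xs = cong (λ k → sumℚ (map F (x ∷ xs)) * (+ 1 / suc k)) (length-map F xs)

avg-mono : ∀ {F G : A → ℚ} (xs : List A) → (∀ x → F x ≤ G x) → avg (map F xs) ≤ avg (map G xs)
avg-mono               []       _   = ≤-refl
avg-mono {F = F} {G} (x ∷ xs) F≤G = begin
  avg (map F (x ∷ xs))         ≡⟨ avg-map-∷ F x xs ⟩
  sumℚ (map F (x ∷ xs)) * w    ≤⟨ *-monoʳ-≤-nonNeg w {{nonNeg-w}} (sumℚ-mono (x ∷ xs) F≤G) ⟩
  sumℚ (map G (x ∷ xs)) * w    ≡⟨ avg-map-∷ G x xs ⟨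
  avg (map G (x ∷ xs))         ∎
  where
  open ≤-Reasoning
  w = + 1 / suc (length xs)
  nonNeg-w = normalize-nonNeg 1 (suc (length xs))

avg-nonNeg : ∀ {F : A → ℚ} (xs : List A) → (∀ x → 0ℚ ≤ F x) → 0ℚ ≤ avg (map F xs)
avg-nonNeg           []       _   = ≤-refl
avg-nonNeg {F = F} (x ∷ xs) 0≤F = begin
  0ℚ                           ≡⟨ *-zeroˡ w ⟨
  0ℚ * w                       ≤⟨ *-monoʳ-≤-nonNeg w {{nonNeg-w}} (sumℚ-nonNeg (x ∷ xs) 0≤F) ⟩
  sumℚ (map F (x ∷ xs)) * w    ≡⟨ avg-map-∷ F x xs ⟨
  avg (map F (x ∷ xs))         ∎
  where
  open ≤-Reasoning
  w = + 1 / suc (length xs)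
  nonNeg-w = normalize-nonNeg 1 (suc (length xs))

filter-map : ∀ {P : Pred B ℓ} (P? : Decidable P) (g : A → B) (xs : List A) →
  filter P? (map g xs) ≡ map g (filter (P? ∘ g) xs)
filter-map P? g [] = refl
filter-map P? g (x ∷ xs) with does (P? (g x))
... | true  = cong (g x ∷_) (filter-map P? g xs)
... | false = filter-map P? g xs

E-cong : ∀ {n} {F G : Vec Bool n → ℚ} → (∀ x → F x ≡ G x) → E F ≡ E G
E-cong {n} F≗G = cong avg (map-cong F≗G (cube n))

E-[] : (F : Vec Bool 0 → ℚ) → E F ≡ F []
E-[] F = trans (*-identityʳ (F [] + 0ℚ)) (+-identityʳ (F []))

E-split : ∀ {n} (F : Vec Bool (suc n) → ℚ) →
  E F ≡ ½ * (E (F ∘ (false ∷_)) + E (F ∘ (true ∷_)))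
E-split {n} F = begin
  avg (map F (map (false ∷_) C ++ map (true ∷_) C))        ≡⟨ cong avg (map-++ F (map (false ∷_) C) (map (true ∷_) C)) ⟩
  avg (map F (map (false ∷_) C) ++ map F (map (true ∷_) C)) ≡⟨ cong₂ (λ xs ys → avg (xs ++ ys)) (map-∘ C) (map-∘ C) ⟨
  avg (map F₀ C ++ map F₁ C)                                ≡⟨ avg-++ (map F₀ C) (map F₁ C) ∣F₀∣≡∣F₁∣ ⟩
  ½ * (E F₀ + E F₁)                                         ∎
  where
  open ≡-Reasoning
  C = cube n
  F₀ F₁ : Vec Bool n → ℚ
  F₀ = F ∘ (false ∷_)
  F₁ = F ∘ (true ∷_)
  ∣F₀∣≡∣F₁∣ : length (map F₀ C) ≡ length (map F₁ C)
  ∣F₀∣≡∣F₁∣ = trans (length-map F₀ C) (sym (length-map F₁ C))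

E-[F-c]² : ∀ {n} (F : Vec Bool n → ℚ) c →
  E (λ x → (F x - c) * (F x - c)) ≡ E (λ x → F x * F x) - (c + c) * E F + c * c
E-[F-c]² {zero} F c = begin
  E (λ x → (F x - c) * (F x - c))                ≡⟨ E-[] (λ x → (F x - c) * (F x - c)) ⟩
  (F [] - c) * (F [] - c)                        ≡⟨ solve 2 (λ y c → (y :- c) :* (y :- c)
                                                                  := y :* y :- (c :+ c) :* y :+ c :* c) refl (F []) c ⟩
  F [] * F [] - (c + c) * F [] + c * c           ≡⟨ cong₂ (λ s y → s - (c + c) * y + c * c) (E-[] (λ x → F x * F x)) (E-[] F) ⟨
  E (λ x → F x * F x) - (c + c) * E F + c * c    ∎
  where open ≡-Reasoning
E-[F-c]² {suc n} F c = begin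
  E (λ x → (F x - c) * (F x - c))
    ≡⟨ E-split (λ x → (F x - c) * (F x - c)) ⟩
  ½ * (E (λ x → (F₀ x - c) * (F₀ x - c)) + E (λ x → (F₁ x - c) * (F₁ x - c)))
    ≡⟨ cong₂ (λ s t → ½ * (s + t)) (E-[F-c]² F₀ c) (E-[F-c]² F₁ c) ⟩
  ½ * ((Q₀ - (c + c) * M₀ + c * c) + (Q₁ - (c + c) * M₁ + c * c))
    -- as a constant, ½ is evaluated by the solver, which thus knows ½ + ½ = 1
    ≡⟨ solve 5 (λ Q₀ Q₁ M₀ M₁ c → con ½ :* ((Q₀ :- (c :+ c) :* M₀ :+ c :* c) :+ (Q₁ :- (c :+ c) :* M₁ :+ c :* c))
                                 := con ½ :* (Q₀ :+ Q₁) :- (c :+ c) :* (con ½ :* (M₀ :+ M₁)) :+ c :* c)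
               refl Q₀ Q₁ M₀ M₁ c ⟩
  ½ * (Q₀ + Q₁) - (c + c) * (½ * (M₀ + M₁)) + c * c
    ≡⟨ cong₂ (λ s m → s - (c + c) * m + c * c) (E-split (λ x → F x * F x)) (E-split F) ⟨
  E (λ x → F x * F x) - (c + c) * E F + c * c
    ∎
  where
  open ≡-Reasoning
  F₀ F₁ : Vec Bool n → ℚ
  F₀ = F ∘ (false ∷_)
  F₁ = F ∘ (true ∷_)
  Q₀ = E (λ x → F₀ x * F₀ x)
  Q₁ = E (λ x → F₁ x * F₁ x)
  M₀ = E F₀
  M₁ = E F₁

holds : (P : A → Bool) → Decidable (λ x → P x ≡ true)
holds P x = P x Bool.≟ true

filter-cube-suc : ∀ {n} (P : Vec Bool (suc n) → Bool) →
  filter (holds P) (cube (suc n)) ≡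
    map (false ∷_) (filter (holds (P ∘ (false ∷_))) (cube n)) ++
    map (true ∷_) (filter (holds (P ∘ (true ∷_))) (cube n))
filter-cube-suc {n} P = trans (filter-++ (holds P) (map (false ∷_) (cube n)) (map (true ∷_) (cube n)))
  (cong₂ _++_ (filter-map (holds P) (false ∷_) (cube n)) (filter-map (holds P) (true ∷_) (cube n)))

filter-cube-head : ∀ {n} (P : Vec Bool (suc n) → Bool) a → (∀ x → P (not a ∷ x) ≢ true) →
  filter (holds P) (cube (suc n)) ≡ map (a ∷_) (filter (holds (P ∘ (a ∷_))) (cube n))
filter-cube-head {n} P false rejected = begin
  filter (holds P) (cube (suc n))          ≡⟨ filter-cube-suc P ⟩
  map (false ∷_) L₀ ++ map (true ∷_) L₁    ≡⟨ cong (λ xs → map (false ∷_) L₀ ++ map (true ∷_) xs) L₁≡[] ⟩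
  map (false ∷_) L₀ ++ []                  ≡⟨ ++-identityʳ (map (false ∷_) L₀) ⟩
  map (false ∷_) L₀                        ∎
  where
  open ≡-Reasoning
  L₀ = filter (holds (P ∘ (false ∷_))) (cube n)
  L₁ = filter (holds (P ∘ (true ∷_))) (cube n)
  L₁≡[] : L₁ ≡ []
  L₁≡[] = filter-none (holds (P ∘ (true ∷_))) (universal rejected (cube n))
filter-cube-head {n} P true rejected = begin
  filter (holds P) (cube (suc n))          ≡⟨ filter-cube-suc P ⟩
  map (false ∷_) L₀ ++ map (true ∷_) L₁    ≡⟨ cong (λ xs → map (false ∷_) xs ++ map (true ∷_) L₁) L₀≡[] ⟩
  map (true ∷_) L₁                         ∎
  where
  open ≡-Reasoning
  L₀ = filter (holds (P ∘ (false ∷_))) (cube n)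
  L₁ = filter (holds (P ∘ (true ∷_))) (cube n)
  L₀≡[] : L₀ ≡ []
  L₀≡[] = filter-none (holds (P ∘ (false ∷_))) (universal rejected (cube n))

avgOn-head : ∀ {n} (P : Vec Bool (suc n) → Bool) (F : Vec Bool (suc n) → ℚ) a →
  (∀ x → P (not a ∷ x) ≢ true) → avgOn P F ≡ avgOn (P ∘ (a ∷_)) (F ∘ (a ∷_))
avgOn-head {n} P F a rejected = cong avg (trans (cong (map F) (filter-cube-head P a rejected))
  (sym (map-∘ {g = F} {f = a ∷_} (filter (holds (P ∘ (a ∷_))) (cube n)))))

avgOn-const-true : ∀ {n} (F : Vec Bool n → ℚ) → avgOn (λ _ → true) F ≡ E F
avgOn-const-true {n} F = cong (avg ∘ map F) (filter-all (holds (λ _ → true)) (universal (λ _ → refl) (cube n)))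

condExp-suc : ∀ {n} r (F : Vec Bool (suc n) → ℚ) a x →
  condExp (suc r) F (a ∷ x) ≡ condExp r (F ∘ (a ∷_)) x
condExp-suc r F false x = avgOn-head (agree (suc r) (false ∷ x)) F false (λ _ ())
condExp-suc r F true  x = avgOn-head (agree (suc r) (true ∷ x)) F true (λ _ ())

condProbOnes-suc : ∀ {n} r (f : Vec Bool (suc n) → Bool) →
  condProbOnes (suc r) f ≡ condProbOnes r (f ∘ (true ∷_))
condProbOnes-suc r f = avgOn-head (firstOnes (suc r)) (ind ∘ f) true (λ _ ())

ind-nonNeg : ∀ b → 0ℚ ≤ ind b
ind-nonNeg true  = nonNegative⁻¹ 1ℚ
ind-nonNeg false = ≤-refl

ind-mono : ∀ {a b} → a ≤ᵇ b → ind a ≤ ind b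
ind-mono b≤b = ≤-refl
ind-mono f≤t = ind-nonNeg true

ind-idem : ∀ b → ind b * ind b ≡ ind b
ind-idem true  = refl
ind-idem false = refl

≤ᵛ-refl : ∀ {n} (x : Vec Bool n) → x ≤ᵛ x
≤ᵛ-refl []      = []≤[]
≤ᵛ-refl (a ∷ x) = ∷≤∷ b≤b (≤ᵛ-refl x)

Monotone-∘∷ : ∀ {n} {f : Vec Bool (suc n) → Bool} a → Monotone f → Monotone (f ∘ (a ∷_))
Monotone-∘∷ a f↑ x y x≤y = f↑ (a ∷ x) (a ∷ y) (∷≤∷ b≤b x≤y)

Monotone⇒false∷≤true∷ : ∀ {n} {f : Vec Bool (suc n) → Bool} → Monotone f →
  ∀ x → f (false ∷ x) ≤ᵇ f (true ∷ x)
Monotone⇒false∷≤true∷ f↑ x = f↑ (false ∷ x) (true ∷ x) (∷≤∷ f≤t (≤ᵛ-refl x))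

condProbOnes-mono : ∀ {n} r {f g : Vec Bool n → Bool} → (∀ x → f x ≤ᵇ g x) →
  condProbOnes r f ≤ condProbOnes r g
condProbOnes-mono {n} r f≤g = avg-mono (filter (holds (firstOnes r)) (cube n)) (ind-mono ∘ f≤g)

condProbOnes-nonNeg : ∀ {n} r (f : Vec Bool n → Bool) → 0ℚ ≤ condProbOnes r f
condProbOnes-nonNeg {n} r f = avg-nonNeg (filter (holds (firstOnes r)) (cube n)) (ind-nonNeg ∘ f)

μ : ∀ {n} → (Vec Bool n → Bool) → ℚ
μ f = E (ind ∘ f)

μ-nonNeg : ∀ {n} (f : Vec Bool n → Bool) → 0ℚ ≤ μ f
μ-nonNeg {n} f = avg-nonNeg (cube n) (ind-nonNeg ∘ f)

residual : ∀ {n} → ℕ → (Vec Bool n → ℚ) → Vec Bool n → ℚ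
residual r F x = F x - condExp r F x

‖_‖² : ∀ {n} → (Vec Bool n → ℚ) → ℚ
‖ h ‖² = E (λ x → h x * h x)

‖residual‖²-zero : ∀ {n} (f : Vec Bool n → Bool) → ‖ residual 0 (ind ∘ f) ‖² ≡ μ f - μ f * μ f
‖residual‖²-zero f = begin
  ‖ residual 0 (ind ∘ f) ‖²
    ≡⟨ E-cong (λ x → cong (λ c → (ind (f x) - c) * (ind (f x) - c)) (avgOn-const-true (ind ∘ f))) ⟩
  E (λ x → (ind (f x) - μ f) * (ind (f x) - μ f))
    ≡⟨ E-[F-c]² (ind ∘ f) (μ f) ⟩
  E (λ x → ind (f x) * ind (f x)) - (μ f + μ f) * μ f + μ f * μ f
    ≡⟨ cong (λ s → s - (μ f + μ f) * μ f + μ f * μ f) (E-cong (ind-idem ∘ f)) ⟩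
  μ f - (μ f + μ f) * μ f + μ f * μ f
    ≡⟨ solve 1 (λ m → m :- (m :+ m) :* m :+ m :* m := m :- m :* m) refl (μ f) ⟩
  μ f - μ f * μ f
    ∎
  where open ≡-Reasoning

‖residual‖²-suc : ∀ {n} r (F : Vec Bool (suc n) → ℚ) →
  ‖ residual (suc r) F ‖² ≡ ½ * (‖ residual r (F ∘ (false ∷_)) ‖² + ‖ residual r (F ∘ (true ∷_)) ‖²)
‖residual‖²-suc r F = trans (E-split (λ x → h x * h x))
  (cong₂ (λ s t → ½ * (s + t)) (E-cong (squared-residual-∷ false)) (E-cong (squared-residual-∷ true)))
  where
  h = residual (suc r) F
  squared-residual-∷ : ∀ a x → h (a ∷ x) * h (a ∷ x) ≡ residual r (F ∘ (a ∷_)) x * residual r (F ∘ (a ∷_)) x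
  squared-residual-∷ a x = cong (λ c → (F (a ∷ x) - c) * (F (a ∷ x) - c)) (condExp-suc r F a x)

μ-condProbOnes*μ≤‖residual‖² : ∀ {n} r → r ≤ℕ n → (f : Vec Bool n → Bool) → Monotone f →
  μ f - condProbOnes r f * μ f ≤ ‖ residual r (ind ∘ f) ‖²
μ-condProbOnes*μ≤‖residual‖² zero _ f _ = ≤-reflexive (begin
  μ f - condProbOnes 0 f * μ f   ≡⟨ cong (λ p → μ f - p * μ f) (avgOn-const-true (ind ∘ f)) ⟩
  μ f - μ f * μ f                ≡⟨ ‖residual‖²-zero f ⟨
  ‖ residual 0 (ind ∘ f) ‖²      ∎)
  where open ≡-Reasoning
μ-condProbOnes*μ≤‖residual‖² {suc n} (suc r) (s≤s r≤n) f f↑ = begin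
  μ f - condProbOnes (suc r) f * μ f
    ≡⟨ cong₂ (λ m p → m - p * m) (E-split (ind ∘ f)) (condProbOnes-suc r f) ⟩
  ½ * (μ f₀ + μ f₁) - p₁ * (½ * (μ f₀ + μ f₁))
    ≡⟨ solve 3 (λ m₀ m₁ p → con ½ :* (m₀ :+ m₁) :- p :* (con ½ :* (m₀ :+ m₁))
                         := con ½ :* ((m₀ :- p :* m₀) :+ (m₁ :- p :* m₁))) refl (μ f₀) (μ f₁) p₁ ⟩
  ½ * ((μ f₀ - p₁ * μ f₀) + (μ f₁ - p₁ * μ f₁))
    ≤⟨ *-monoˡ-≤-nonNeg ½ (+-mono-≤ (≤-trans μ₀-p₁μ₀≤μ₀-p₀μ₀ IH₀) IH₁) ⟩
  ½ * (‖ residual r (ind ∘ f₀) ‖² + ‖ residual r (ind ∘ f₁) ‖²)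
    ≡⟨ ‖residual‖²-suc r (ind ∘ f) ⟨
  ‖ residual (suc r) (ind ∘ f) ‖²
    ∎
  where
  open ≤-Reasoning
  f₀ f₁ : Vec Bool n → Bool
  f₀ = f ∘ (false ∷_)
  f₁ = f ∘ (true ∷_)
  p₀ = condProbOnes r f₀
  p₁ = condProbOnes r f₁
  IH₀ = μ-condProbOnes*μ≤‖residual‖² r r≤n f₀ (Monotone-∘∷ false f↑)
  IH₁ = μ-condProbOnes*μ≤‖residual‖² r r≤n f₁ (Monotone-∘∷ true f↑)
  μ₀-p₁μ₀≤μ₀-p₀μ₀ : μ f₀ - p₁ * μ f₀ ≤ μ f₀ - p₀ * μ f₀
  μ₀-p₁μ₀≤μ₀-p₀μ₀ = +-monoʳ-≤ (μ f₀) (neg-antimono-≤ (*-monoʳ-≤-nonNeg (μ f₀) {{0≤μ₀}} p₀≤p₁))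
    where
    0≤μ₀ = nonNegative (μ-nonNeg f₀)
    p₀≤p₁ = condProbOnes-mono r (Monotone⇒false∷≤true∷ f↑)

lemma3p5 : (n r : ℕ) → r ≤ℕ n → (f : Vec Bool n → Bool) → Monotone f →
    let μ = E (λ x → ind (f x))
        h = λ x → ind (f x) - condExp r (λ y → ind (f y)) x
    in E (λ x → h x * h x) ≤ μ - (μ + μ) * μ →
       μ + μ ≤ condProbOnes r f
lemma3p5 n r r≤n f f↑ ‖h‖²≤μ-2μ² =
  [m+m]*m≤p*m⇒m+m≤p (μ-nonNeg f) (condProbOnes-nonNeg r f)
    (m-p≤m-q⇒q≤p {μ f} (≤-trans (μ-condProbOnes*μ≤‖residual‖² r r≤n f f↑) ‖h‖²≤μ-2μ²))
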